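{- Let $T$ be a (left or right) concatenation tree and $\alpha_1,\dots,\alpha_t$ its node labels in RCL order, indices modulo $t$. Fix $j$. If $\alpha_j$ is periodic with period $p$ and acceptable range $\{kp+1,\dots,kp+p\}$, then $\mathrm{ap}(\alpha_j)^k$ is a prefix of $\alpha_{j+1}$.
   Context: Strings of length $n$ over a finite ordered alphabet. $\mathrm{ap}(\alpha)$ is the shortest $\beta$ with $\alpha=\beta^q$ for some $q\ge1$; $|\beta|$ is the period; $\alpha$ is periodic if its period is less than $n$. A PCR-based cycle-joining tree $\mathcal{T}$ is a rooted tree whose nodes are distinct rotation classes of strings, each named by its lexicographically least rotation (necklace), where the edge from node $u$ to child $v$ is labeled by a conjugate pair $(\mathtt{x}\beta,\mathtt{y}\beta)$ ($\mathtt{x}\neq\mathtt{y}$ symbols, $|\beta|=n-1$) with $\mathtt{x}\beta$ a rotation in $u$ and $\mathtt{y}\beta$ a rotation in $v$; it satisfies the Chain Property if no node has two children with edge labels sharing the same $\beta$. A concatenation tree $\mathrm{concat}(\mathcal{T},c,\ell)$, for such $\mathcal{T}$ with the Chain Property, $c\in\{1,\dots,n\}$, $\ell\in\{\mathit{left},\mathit{right}\}$, has the same nodes and parent relation, each node carrying a label (a rotation in its class) and a change index: the root has label its necklace and change index $c$; if a node has label $\alpha$, change index $c'$ and period $p$, with $jp<c'\le jp+p$, its acceptable range is $\{jp+1,\dots,jp+p\}$; a child joined by $(\mathtt{x}\beta,\mathtt{y}\beta)$ gets label $\beta_1\mathtt{y}\beta_2$ and change index $|\beta_1|+1$, where $\alpha=\beta_1\mathtt{x}\beta_2$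 is the unique factorization with $\beta_2\beta_1=\beta$ and $|\beta_1|+1$ in the acceptable range. Children with change index $<c'$ are left-children, $>c'$ right-children, and $=c'$ left-children if $\ell=\mathit{left}$, right-children if $\ell=\mathit{right}$; each type ordered by increasing change index. RCL order: recursively, the right-children subtrees first to last, then the node, then the left-children subtrees first to last. -}

module Defs where

open import Data.Nat using (ℕ; zero; suc; _+_; _*_; _∸_; _≤_; _<_; _<ᵇ_; _<?_)
open import Data.Bool using (Bool; true; false; not; if_then_else_)
open import Data.Fin using (Fin; toℕ; fromℕ<)
import Data.Fin as F
open import Data.List using (List; []; _∷_; _++_; length; map)
open import Data.List.Relation.Unary.All using (All)
open import Data.List.Relation.Unary.Linked using (Linked)
open import Data.Product using (Σ; _×_; _,_; proj₁; proj₂; ∃)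
open import Data.Sum using (_⊎_)
open import Data.Unit using (⊤)
open import Data.Empty using (⊥)
open import Relation.Binary.PropositionalEquality using (_≡_; _≢_)
open import Relation.Nullary using (yes; no)

Word : ℕ → Set
Word σ = List (Fin σ)

_^ʷ_ : ∀ {σ} → Word σ → ℕ → Word σ
β ^ʷ zero  = []
β ^ʷ suc q = β ++ (β ^ʷ q)

IsPrefix : ∀ {σ} → Word σ → Word σ → Set
IsPrefix {σ} u w = Σ (Word σ) λ s → u ++ s ≡ w

IsRot : ∀ {σ} → Word σ → Word σ → Set
IsRot {σ} u v = Σ (Word σ) λ a → Σ (Word σ) λ b → v ≡ a ++ b × u ≡ b ++ a

LexLeq : ∀ {σ} → Word σ → Word σ → Set
LexLeq [] _ = ⊤
LexLeq (a ∷ as) [] = ⊥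
LexLeq (a ∷ as) (b ∷ bs) = (a F.< b) ⊎ (a ≡ b × LexLeq as bs)

IsNecklace : ∀ {σ} → Word σ → Set
IsNecklace {σ} α = ∀ (u v : Word σ) → α ≡ u ++ v → LexLeq α (v ++ u)

IsAp : ∀ {σ} → Word σ → Word σ → Set
IsAp {σ} α β =
  (Σ ℕ λ q → 1 ≤ q × α ≡ β ^ʷ q) ×
  (∀ (γ : Word σ) (q : ℕ) → 1 ≤ q → α ≡ γ ^ʷ q → length β ≤ length γ)

InAccRange : ∀ {σ} → Word σ → ℕ → ℕ → Set
InAccRange {σ} α c' i =
  Σ (Word σ) λ β → IsAp α β × Σ ℕ λ j →
    (j * length β < c' × c' ≤ j * length β + length β) ×
    (j * length β < i × i ≤ j * length β + length β)

-- Trees: each node carries its name (necklace of its rotation class), its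
-- concatenation-tree label, its change index, and its children, each child
-- together with the edge label (xβ, yβ) stored as (x , y , β).
data CTree (σ : ℕ) : Set where
  node : (name : Word σ) (label : Word σ) (ci : ℕ)
         (kids : List (Fin σ × Fin σ × Word σ × CTree σ)) → CTree σ

nameOf : ∀ {σ} → CTree σ → Word σ
nameOf (node nm _ _ _) = nm

labelOf : ∀ {σ} → CTree σ → Word σ
labelOf (node _ lab _ _) = lab

ciOf : ∀ {σ} → CTree σ → ℕ
ciOf (node _ _ c _) = c

Kid : ℕ → Set
Kid σ = Fin σ × Fin σ × Word σ × CTree σ

kidTree : ∀ {σ} → Kid σ → CTree σ
kidTree (_ , _ , _ , t) = t

kidβ : ∀ {σ} → Kid σ → Word σ
kidβ (_ , _ , β , _) = β

mutual
  names : ∀ {σ} → CTree σ → List (Word σ)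
  names (node nm _ _ ks) = nm ∷ namesKids ks

  namesKids : ∀ {σ} → List (Kid σ) → List (Word σ)
  namesKids [] = []
  namesKids ((_ , _ , _ , t) ∷ ks) = names t ++ namesKids ks

-- Conditions on the edge to one child, given the parent's name, label and
-- change index: PCR edge condition and the concatenation-tree labelling rule.
KidOK : ∀ {σ} → ℕ → Word σ → Word σ → ℕ → Kid σ → Set
KidOK {σ} n nm lab c (x , y , β , t) =
  x ≢ y × length β ≡ n ∸ 1 ×
  IsRot (x ∷ β) nm × IsRot (y ∷ β) (nameOf t) ×
  Σ (Word σ) λ β₁ → Σ (Word σ) λ β₂ →
    lab ≡ β₁ ++ x ∷ β₂ × β₂ ++ β₁ ≡ β ×
    InAccRange lab c (suc (length β₁)) ×
    labelOf t ≡ β₁ ++ y ∷ β₂ × ciOf t ≡ suc (length β₁)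

open import Data.List.Relation.Unary.Unique.Propositional using (Unique)

-- Children are listed by strictly increasing change index; the Chain
-- Property says the β's of the children's edge labels are distinct.
data WF {σ : ℕ} (n : ℕ) : CTree σ → Set where
  wf : ∀ {nm lab c} {ks : List (Kid σ)} →
       length nm ≡ n → IsNecklace nm → length lab ≡ n →
       All (λ k → KidOK n nm lab c k × WF n (kidTree k)) ks →
       Unique (map kidβ ks) →
       Linked _<_ (map (λ k → ciOf (kidTree k)) ks) →
       WF n (node nm lab c ks)

-- T is concat(T₀, c, ℓ) for a PCR-based cycle-joining tree T₀ with the Chain
-- Property on strings of length n (ℓ only affects the child types / RCL order).
IsConcatTree : ∀ {σ} → ℕ → ℕ → CTree σ → Set
IsConcatTree n c T =
  WF n T × Unique (names T) × 1 ≤ c × c ≤ n ×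
  labelOf T ≡ nameOf T × ciOf T ≡ c

data Side : Set where
  left right : Side

isRightChild : Side → ℕ → ℕ → Bool
isRightChild left  c' d = c' <ᵇ d
isRightChild right c' d = not (d <ᵇ c')

mutual
  rcl : ∀ {σ} → Side → CTree σ → List (Word σ × ℕ)
  rcl ℓ (node nm lab c ks) =
    rclKids ℓ c true ks ++ (lab , c) ∷ rclKids ℓ c false ks

  rclKids : ∀ {σ} → Side → ℕ → Bool → List (Kid σ) → List (Word σ × ℕ)
  rclKids ℓ c b [] = []
  rclKids ℓ c b ((_ , _ , _ , t) ∷ ks) =
    (if isRightChild ℓ c (ciOf t)
       then (if b then rcl ℓ t else [])
       else (if b then [] else rcl ℓ t))
    ++ rclKids ℓ c b ks

cycSuc : ∀ {t} → Fin t → Fin t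
cycSuc {suc t} i with suc (toℕ i) <? suc t
... | yes p = fromℕ< p
... | no _ = Fin.zero

{-# OPTIONS --safe #-}
module Submission where

-- Write kp for the left end of the acceptable range of an RCL entry (α , c′), p = |ap α|.
-- A child's label agrees with its parent's label before the child's change index, and that index
-- lies in the parent's acceptable range, hence above the parent's kp. Between an entry and its
-- RCL successor the walk only crosses edges whose change index exceeds the entry's kp: right
-- children lie above the parent's index, left children below it, and siblings come in increasing
-- order. So consecutive labels share their first kp symbols; since α is a power of ap α and
-- kp < c′ ≤ |α|, that prefix is ap(α)^k. The wrap-around from the last entry to the first one
-- passes through the root, whose change index bounds the kp of the last entry.

open import Defs
open import Data.Nat using (ℕ; zero; suc; _*_; _+_; _≤_; _<_; z≤n; s≤s; s≤s⁻¹; _<?_)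
open import Data.Nat.Properties
open import Data.Fin using (Fin; toℕ; fromℕ<)
open import Data.List using (List; []; _∷_; _++_; length; lookup; take; drop; map)
open import Data.List.Properties using (length-++; ++-assoc; take-all; take++drop≡id)
open import Data.List.Relation.Unary.All as All using (All; []; _∷_)
open import Data.List.Relation.Unary.All.Properties using (map⁻)
open import Data.List.Relation.Unary.AllPairs as AllPairs using ()
open import Data.List.Relation.Unary.Linked as Linked using (Linked)
open import Data.List.Relation.Unary.Linked.Properties using (Linked⇒AllPairs)
open import Data.Product using (Σ-syntax; _×_; _,_; proj₁; proj₂)
open import Data.Bool using (Bool; true; false; if_then_else_; T)
open import Data.Bool.Properties using (not-injective) renaming (_≟_ to _≟ᵇ_)
open import Data.Unit using (⊤; tt)
open import Data.Empty using (⊥-elim)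
open import Function using (_∘′_)
open import Relation.Binary.PropositionalEquality
open import Relation.Nullary using (¬_; yes; no)

module _ {A : Set} where

  take-++ˡ : ∀ {m} (xs ys : List A) → m ≤ length xs → take m (xs ++ ys) ≡ take m xs
  take-++ˡ {zero}  xs       ys _         = refl
  take-++ˡ {suc m} (x ∷ xs) ys (s≤s m≤) = cong (x ∷_) (take-++ˡ xs ys m≤)

  data Chain (R : A → A → Set) : A → List A → A → Set where
    []  : ∀ {x} → Chain R x [] x
    _∷_ : ∀ {x y ys z} → R x y → Chain R y ys z → Chain R x (y ∷ ys) z

  module _ {R : A → A → Set} where

    chain-++ : ∀ {x y z xs ys} → Chain R x xs y → Chain R y ys z → Chain R x (xs ++ ys) z
    chain-++ []        c = c
    chain-++ (r ∷ c′) c = r ∷ chain-++ c′ c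

    chain-lookup : ∀ {x xs z} → Chain R x xs z → (i : Fin (suc (length xs))) →
      (i<last : suc (toℕ i) < suc (length xs)) →
      R (lookup (x ∷ xs) i) (lookup (x ∷ xs) (fromℕ< i<last))
    chain-lookup []      Fin.zero    (s≤s ())
    chain-lookup (r ∷ c) Fin.zero    _         = r
    chain-lookup (r ∷ c) (Fin.suc i) (s≤s i<) = chain-lookup c i i<

    chain-lookup-last : ∀ {x xs z} → Chain R x xs z → (i : Fin (suc (length xs))) →
      ¬ suc (toℕ i) < suc (length xs) → lookup (x ∷ xs) i ≡ z
    chain-lookup-last []      Fin.zero    _     = refl
    chain-lookup-last (r ∷ c) Fin.zero    i≮ = ⊥-elim (i≮ (s≤s (s≤s z≤n)))
    chain-lookup-last (r ∷ c) (Fin.suc i) i≮ = chain-lookup-last c i (i≮ ∘′ s≤s)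

    -- The second chain starts where the first one ends; its first link closes the cycle.
    chain-cycSuc : ∀ {x y z xs} → Chain R x xs y → Chain R y xs z →
      (i : Fin (length xs)) → R (lookup xs i) (lookup xs (cycSuc i))
    chain-cycSuc {xs = w ∷ ws} (_ ∷ c) (wrap ∷ _) i with suc (toℕ i) <? suc (length ws)
    ... | yes i<last = chain-lookup c i i<last
    ... | no  i≮last rewrite chain-lookup-last c i i≮last = wrap

module _ {σ : ℕ} where

  length-^ʷ : (β : Word σ) (q : ℕ) → length (β ^ʷ q) ≡ q * length β
  length-^ʷ β zero    = refl
  length-^ʷ β (suc q) = trans (length-++ β) (cong (length β +_) (length-^ʷ β q))

  ^ʷ-isPrefix : (β : Word σ) {k q : ℕ} → k ≤ q → IsPrefix (β ^ʷ k) (β ^ʷ q)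
  ^ʷ-isPrefix β {zero}  {q}     _        = β ^ʷ q , refl
  ^ʷ-isPrefix β {suc k} {suc q} (s≤s k≤q) with ^ʷ-isPrefix β k≤q
  ... | s , eq = s , trans (++-assoc β (β ^ʷ k) s) (cong (β ++_) eq)

  isPrefix-transfer : {u v w : Word σ} → IsPrefix u v →
    take (length u) v ≡ take (length u) w → IsPrefix u w
  isPrefix-transfer {u} {v} {w} (s , refl) agree = drop (length u) w , (begin
    u ++ drop (length u) w                     ≡⟨ cong (_++ drop (length u) w) u≡take ⟩
    take (length u) w ++ drop (length u) w     ≡⟨ take++drop≡id (length u) w ⟩
    w                                          ∎)
    where
    open ≡-Reasoning
    u≡take : u ≡ take (length u) w
    u≡take = trans (sym (trans (take-++ˡ u s ≤-refl) (take-all (length u) u ≤-refl))) agree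

  ap-length-unique : {α β β′ : Word σ} → IsAp α β → IsAp α β′ → length β ≡ length β′
  ap-length-unique ((q , 1≤q , α≡β^q) , β-min) ((q′ , 1≤q′ , α≡β′^q′) , β′-min) =
    ≤-antisym (β-min _ q′ 1≤q′ α≡β′^q′) (β′-min _ q 1≤q α≡β^q)

block-index-≤ : ∀ {p k j c} → k * p < c → c ≤ j * p + p → k ≤ j
block-index-≤ {p} {k} {j} kp<c c≤jp+p =
  s≤s⁻¹ (*-cancelʳ-< p k (suc j) (<-≤-trans kp<c (≤-trans c≤jp+p (≤-reflexive (+-comm (j * p) p)))))

rightChild⇒≤ : ∀ ℓ {c d} → isRightChild ℓ c d ≡ true → c ≤ d
rightChild⇒≤ left  {c} {d} isRight = <⇒≤ (<ᵇ⇒< c d (subst T (sym isRight) tt))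
rightChild⇒≤ right {c} {d} isRight = ≮⇒≥ λ d<c → subst T (not-injective isRight) (<⇒<ᵇ d<c)

leftChild⇒≥ : ∀ ℓ {c d} → isRightChild ℓ c d ≡ false → d ≤ c
leftChild⇒≥ left  {c} {d} isLeft = ≮⇒≥ λ c<d → subst T isLeft (<⇒<ᵇ c<d)
leftChild⇒≥ right {c} {d} isLeft = <⇒≤ (<ᵇ⇒< d c (subst T (sym (not-injective isLeft)) tt))

module _ {A : Set} (L : List A) where

  selected : ∀ {r b} → r ≡ b → (if r then (if b then L else []) else (if b then [] else L)) ≡ L
  selected {true}  refl = refl
  selected {false} refl = refl

  skipped : ∀ {r b} → ¬ r ≡ b → (if r then (if b then L else []) else (if b then [] else L)) ≡ []
  skipped {true}  {true}  r≢b = ⊥-elim (r≢b refl)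
  skipped {true}  {false} _   = refl
  skipped {false} {true}  _   = refl
  skipped {false} {false} r≢b = ⊥-elim (r≢b refl)

Entry : ℕ → Set
Entry σ = Word σ × ℕ

module _ {σ : ℕ} where

  BlockStart : Entry σ → ℕ → Set
  BlockStart (α , c′) m = Σ[ β ∈ Word σ ] IsAp α β × Σ[ k ∈ ℕ ]
    k * length β < c′ × c′ ≤ k * length β + length β × m ≡ k * length β

  Fits : Entry σ → Set
  Fits (α , c′) = c′ ≤ length α

  KeepsBlockPrefix : Entry σ → Entry σ → Set
  KeepsBlockPrefix e e′ =
    Fits e × (∀ m → BlockStart e m → take m (proj₁ e) ≡ take m (proj₁ e′))

  BlockAgrees : Entry σ → Word σ → (ℕ → Set) → Set
  BlockAgrees e w P = Fits e × (∀ m → BlockStart e m → P m × take m (proj₁ e) ≡ take m w)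

  Enters : Entry σ → CTree σ → Set
  Enters e t = BlockAgrees e (labelOf t) (_< ciOf t)

  blockStart<ci : ∀ {e m} → BlockStart e m → m < proj₂ e
  blockStart<ci (_ , _ , _ , kp<c , _ , refl) = kp<c

  blockStart<inAccRange : ∀ {α c m d} → BlockStart (α , c) m → InAccRange α c d → m < d
  blockStart<inAccRange {c = c} {d = d}
    (β , ap , k , kp<c , _ , refl) (β′ , ap′ , j , (_ , c≤jp+p) , (jp<d , _)) =
    ≤-<-trans (*-monoˡ-≤ (length β) k≤j) (subst (λ p → j * p < d) (sym p≡p′) jp<d)
    where
    p≡p′ : length β ≡ length β′
    p≡p′ = ap-length-unique ap ap′
    k≤j : k ≤ j
    k≤j = block-index-≤ kp<c (subst (λ p → c ≤ j * p + p) (sym p≡p′) c≤jp+p)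

  blockAgrees-map : ∀ {e w w′} {P Q : ℕ → Set} →
    (∀ {m} → P m → Q m × take m w ≡ take m w′) → BlockAgrees e w P → BlockAgrees e w′ Q
  blockAgrees-map f (fits , agree) = fits , λ m start →
    let (pm , e≡w) = agree m start ; (qm , w≡w′) = f pm in qm , trans e≡w w≡w′

  blockAgrees-keeps : ∀ {e w c P} → BlockAgrees e w P → KeepsBlockPrefix e (w , c)
  blockAgrees-keeps (fits , agree) = fits , λ m start → proj₂ (agree m start)

module Children {σ : ℕ} (n : ℕ) where

  -- A child's label differs from its parent's only at the child's change index.
  child-take : ∀ {nm lab c} (κ : Kid σ) → KidOK n nm lab c κ → ∀ {m} → m < ciOf (kidTree κ) →
    take m lab ≡ take m (labelOf (kidTree κ))
  child-take (x , y , β , t) (_ , _ , _ , _ , β₁ , β₂ , lab≡ , _ , _ , label≡ , ci≡) {m} m<ci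
    rewrite lab≡ | label≡ | ci≡ =
    trans (take-++ˡ β₁ (x ∷ β₂) (s≤s⁻¹ m<ci)) (sym (take-++ˡ β₁ (y ∷ β₂) (s≤s⁻¹ m<ci)))

  child-fits : ∀ {nm lab c} (κ : Kid σ) → KidOK n nm lab c κ → Fits (labelOf (kidTree κ) , ciOf (kidTree κ))
  child-fits (x , y , β , t) (_ , _ , _ , _ , β₁ , β₂ , _ , _ , _ , label≡ , ci≡)
    rewrite label≡ | ci≡ =
    subst (suc (length β₁) ≤_) (sym (trans (length-++ β₁) (+-suc (length β₁) (length β₂))))
      (s≤s (m≤m+n (length β₁) (length β₂)))

  child-inAccRange : ∀ {nm lab c} (κ : Kid σ) → KidOK n nm lab c κ →
    InAccRange lab c (ciOf (kidTree κ))
  child-inAccRange (x , y , β , t) (_ , _ , _ , _ , _ , _ , _ , _ , inRange , _ , ci≡)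
    rewrite ci≡ = inRange

module Traversal {σ : ℕ} (n : ℕ) (ℓ : Side) where

  open Children {σ} n

  ChildOK : Word σ → Word σ → ℕ → Kid σ → Set
  ChildOK nm lab c κ = KidOK n nm lab c κ × WF n (kidTree κ)

  childCis : List (Kid σ) → List ℕ
  childCis = map (λ κ → ciOf (kidTree κ))

  BelowChildren : ℕ → Bool → List (Kid σ) → ℕ → Set
  BelowChildren c b ks m =
    All (λ κ → isRightChild ℓ c (ciOf (kidTree κ)) ≡ b → m < ciOf (kidTree κ)) ks

  mutual
    rcl-chain : (t : CTree σ) → WF n t → Fits (labelOf t , ciOf t) →
      ∀ {e} → Enters e t → Σ[ e′ ∈ Entry σ ] Chain KeepsBlockPrefix e (rcl ℓ t) e′ × Enters e′ t
    rcl-chain (node nm lab c ks) (wf _ _ _ oks _ sorted) fits e↝t =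
      let (e₁ , rightChain , e₁↝) = rclKids-chain nm lab c true (λ _ → ⊤) (λ _ _ → tt) ks oks sorted
                                      (blockAgrees-map enterRight e↝t)
          (e₂ , leftChain , e₂↝)  = rclKids-chain nm lab c false (_< c) belowParent ks oks sorted own
      in e₂ , chain-++ rightChain (blockAgrees-keeps {c = c} e₁↝ ∷ leftChain) , e₂↝
      where
      enterRight : ∀ {m} → m < c → (⊤ × BelowChildren c true ks m) × take m lab ≡ take m lab
      enterRight m<c =
        (tt , All.universal (λ _ isRight → <-≤-trans m<c (rightChild⇒≤ ℓ isRight)) ks) , refl
      belowParent : ∀ {m d} → isRightChild ℓ c d ≡ false → m < d → m < c
      belowParent isLeft m<d = <-≤-trans m<d (leftChild⇒≥ ℓ isLeft)
      own : BlockAgrees (lab , c) lab (λ m → m < c × BelowChildren c false ks m)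
      own = fits , λ m start →
        (blockStart<ci start ,
         All.map (λ {κ} ok _ → blockStart<inAccRange start (child-inAccRange κ (proj₁ ok))) oks) ,
        refl

    -- X is what the exit entry's block start must satisfy: nothing after the right children,
    -- lying below the parent's change index after the left children.
    rclKids-chain : (nm lab : Word σ) (c : ℕ) (b : Bool) (X : ℕ → Set) →
      (∀ {m d} → isRightChild ℓ c d ≡ b → m < d → X m) →
      (ks : List (Kid σ)) → All (ChildOK nm lab c) ks → Linked _<_ (childCis ks) →
      ∀ {e} → BlockAgrees e lab (λ m → X m × BelowChildren c b ks m) →
      Σ[ e′ ∈ Entry σ ] Chain KeepsBlockPrefix e (rclKids ℓ c b ks) e′ × BlockAgrees e′ lab X
    rclKids-chain nm lab c b X child⇒X [] _ _ e↝ = _ , [] , blockAgrees-map (λ xm → proj₁ xm , refl) e↝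
    rclKids-chain nm lab c b X child⇒X (κ@(_ , _ , _ , t) ∷ ks) ((ok , wf-t) ∷ oks) sorted e↝
      with isRightChild ℓ c (ciOf t) ≟ᵇ b
    ... | no side≢b rewrite skipped (rcl ℓ t) side≢b =
      rclKids-chain nm lab c b X child⇒X ks oks (Linked.tail sorted)
        (blockAgrees-map (λ { (xm , _ ∷ below) → (xm , below) , refl }) e↝)
    ... | yes side≡b rewrite selected (rcl ℓ t) side≡b =
      let (e₁ , subtreeChain , e₁↝t) = rcl-chain t wf-t (child-fits κ ok) (blockAgrees-map enter e↝)
          (e₂ , restChain , e₂↝)     = rclKids-chain nm lab c b X child⇒X ks oks (Linked.tail sorted)
                                         (blockAgrees-map leave e₁↝t)
      in e₂ , chain-++ subtreeChain restChain , e₂↝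
      where
      later : All (λ κ′ → ciOf t < ciOf (kidTree κ′)) ks
      later = map⁻ (AllPairs.head (Linked⇒AllPairs <-trans sorted))
      enter : ∀ {m} → X m × BelowChildren c b (κ ∷ ks) m →
        m < ciOf t × take m lab ≡ take m (labelOf t)
      enter (_ , m<ci ∷ _) = m<ci side≡b , child-take κ ok (m<ci side≡b)
      leave : ∀ {m} → m < ciOf t → (X m × BelowChildren c b ks m) × take m (labelOf t) ≡ take m lab
      leave m<ci = (child⇒X side≡b m<ci , All.map (λ ci<ci′ _ → <-trans m<ci ci<ci′) later) ,
                   sym (child-take κ ok m<ci)

  -- The sentinel (label , 0) has no block start, so it enters the root vacuously; the last entry
  -- of the traversal enters the root again, so a second traversal links it to the first entry.
  rcl-keepsBlockPrefix : ∀ {c} (T : CTree σ) → IsConcatTree n c T → (j : Fin (length (rcl ℓ T))) →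
    KeepsBlockPrefix (lookup (rcl ℓ T) j) (lookup (rcl ℓ T) (cycSuc j))
  rcl-keepsBlockPrefix T (wf-T@(wf _ _ |label|≡n _ _ _) , _ , _ , c≤n , _ , ci≡c) =
    let (_ , firstPass , last↝T) = rcl-chain T wf-T fits sentinel
        (_ , secondPass , _)        = rcl-chain T wf-T fits last↝T
    in chain-cycSuc firstPass secondPass
    where
    fits : Fits (labelOf T , ciOf T)
    fits = subst₂ _≤_ (sym ci≡c) (sym |label|≡n) c≤n
    sentinel : Enters (labelOf T , 0) T
    sentinel = z≤n , λ m start → ⊥-elim (n≮0 (blockStart<ci start))

lemma5 : ∀ {σ : ℕ} (n c : ℕ) (ℓ : Side) (T : CTree σ) → IsConcatTree n c T →
    (j : Fin (length (rcl ℓ T))) →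
    (β : Word σ) → IsAp (proj₁ (lookup (rcl ℓ T) j)) β → length β < n →
    (k : ℕ) → k * length β < proj₂ (lookup (rcl ℓ T) j) →
    proj₂ (lookup (rcl ℓ T) j) ≤ k * length β + length β →
    IsPrefix (β ^ʷ k) (proj₁ (lookup (rcl ℓ T) (cycSuc j)))
lemma5 n c ℓ T isConcat j β ap@((q , _ , α≡β^q) , _) _ k kp<ci ci≤kp+p
  with Traversal.rcl-keepsBlockPrefix n ℓ T isConcat j
... | ci≤|α| , keeps = isPrefix-transfer β^k-prefix (keeps (length (β ^ʷ k)) start)
  where
  start : BlockStart (lookup (rcl ℓ T) j) (length (β ^ʷ k))
  start = β , ap , k , kp<ci , ci≤kp+p , length-^ʷ β k
  k<q : k < q
  k<q = *-cancelʳ-< (length β) k q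
    (<-≤-trans kp<ci (≤-trans ci≤|α| (≤-reflexive (trans (cong length α≡β^q) (length-^ʷ β q)))))
  β^k-prefix : IsPrefix (β ^ʷ k) (proj₁ (lookup (rcl ℓ T) j))
  β^k-prefix = subst (IsPrefix (β ^ʷ k)) (sym α≡β^q) (^ʷ-isPrefix β (<⇒≤ k<q))
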